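{- A graph $G$ on vertices $v_1,\dots,v_n$ admits a triangle-free exact-distance square root if and only if there is a collection $Cl_1,\dots,Cl_n$ of cliques of $G$ satisfying: (a) $v_i\notin Cl_i$ for each $i$; (b) for each pair $i,j$, if $v_i\in Cl_j$ then $v_j\in Cl_i$; (c) for distinct $i,j$, $v_i\sim v_j$ in $G$ if and only if $Cl_i\cap Cl_j\neq\emptyset$; (d) for each $i\in[n]$ and each pair $v_j,v_k$ of vertices of $Cl_i$, we have $v_j\notin Cl_k$.
   Context: All graphs are finite and simple. A clique of $G$ is a set of vertices inducing a complete subgraph. For a graph $H=(V,E)$, its exact-distance square $H^{[\sharp 2]}$ is the graph with vertex set $V$ in which distinct vertices $x,y$ are adjacent if and only if their distance in $H$ is exactly $2$; $H$ is an exact-distance square root of $G$ if $V(H)=V(G)$ and $H^{[\sharp 2]}=G$. -}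

module Defs where

open import Data.Nat using (ℕ)
open import Data.Fin using (Fin)
open import Data.Fin.Subset using (Subset; _∈_; _∉_)
open import Data.Product using (Σ; ∃; _×_; _,_)
open import Data.Empty using (⊥)
open import Data.Bool using (Bool; true; false; T)
open import Relation.Nullary using (¬_)
open import Relation.Binary.PropositionalEquality using (_≡_)
open import Function.Bundles using (_⇔_)
open import Level using (0ℓ)

record Graph (n : ℕ) : Set₁ where
  field
    adj       : Fin n → Fin n → Bool
    sym       : ∀ x y → adj x y ≡ adj y x
    irreflex  : ∀ x → adj x x ≡ false

open Graph public

Adj : ∀ {n} → Graph n → Fin n → Fin n → Set
Adj G x y = T (adj G x y)

Dist2 : ∀ {n} → Graph n → Fin n → Fin n → Set
Dist2 H x y = ¬ (x ≡ y) × ¬ Adj H x y × ∃ λ z → Adj H x z × Adj H z y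

IsExactDistSqRoot : ∀ {n} → Graph n → Graph n → Set
IsExactDistSqRoot H G = ∀ x y → (Adj G x y ⇔ Dist2 H x y)

TriangleFree : ∀ {n} → Graph n → Set
TriangleFree H = ∀ x y z → Adj H x y → Adj H y z → Adj H x z → ⊥

IsClique : ∀ {n} → Graph n → Subset n → Set
IsClique G C = ∀ x y → x ∈ C → y ∈ C → ¬ (x ≡ y) → Adj G x y

Meets : ∀ {n} → Subset n → Subset n → Set
Meets C D = ∃ λ z → z ∈ C × z ∈ D

CliqueCollection : ∀ {n} → Graph n → (Fin n → Subset n) → Set
CliqueCollection G Cl =
    (∀ i → IsClique G (Cl i))
  × (∀ i → i ∉ Cl i)
  × (∀ i j → i ∈ Cl j → j ∈ Cl i)
  × (∀ i j → ¬ (i ≡ j) → (Adj G i j ⇔ Meets (Cl i) (Cl j)))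
  × (∀ i j k → j ∈ Cl i → k ∈ Cl i → j ∉ Cl k)

module Submission where

open import Defs
open import Data.Nat using (ℕ)
open import Data.Fin using (Fin)
open import Data.Fin.Subset using (Subset; _∈_; _∉_)
open import Data.Product using (∃; _×_; _,_)
open import Data.Bool using (true; false; T)
open import Data.Bool.Properties using (T-≡)
open import Data.Vec using (lookup; tabulate)
open import Data.Vec.Properties using (lookup⇒[]=; []=⇒lookup; lookup∘tabulate)
open import Data.Empty using (⊥-elim)
open import Relation.Nullary using (¬_)
open import Relation.Binary.PropositionalEquality using (_≡_; refl; subst) renaming (sym to ≡-sym)
open import Function.Bundles using (_⇔_; mk⇔; Equivalence)
open import Function.Properties.Equivalence using () renaming (sym to ⇔-sym)

open Equivalence using (to; from)

-- Take Cl_i to be the neighbourhood of v_i in H.  In a triangle-free graph two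
-- distinct vertices with a common neighbour are never adjacent, so they are at
-- distance exactly 2; hence v_i ~ v_j in G iff Cl_i meets Cl_j, each Cl_i is a
-- clique of G, and (d) says precisely that H has no triangle.  Conversely,
-- (a) and (b) make "v_j ∈ Cl_i" an irreflexive symmetric relation, i.e. a graph H
-- whose neighbourhoods are the Cl_i, and the same facts read backwards show that
-- H is a triangle-free exact-distance square root of G.

T-injective : ∀ {a b} → (T a → T b) → (T b → T a) → a ≡ b
T-injective {false} {false} _ _ = refl
T-injective {false} {true}  _ f = ⊥-elim (f _)
T-injective {true}  {false} t _ = ⊥-elim (t _)
T-injective {true}  {true}  _ _ = refl

¬T⇒≡false : ∀ {a} → ¬ T a → a ≡ false
¬T⇒≡false {false} _  = refl
¬T⇒≡false {true}  ¬t = ⊥-elim (¬t _)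

∈⇔T-lookup : ∀ {n} {C : Subset n} {x} → x ∈ C ⇔ T (lookup C x)
∈⇔T-lookup {C = C} {x} = mk⇔
  (λ x∈C → from T-≡ ([]=⇒lookup x∈C))
  (λ t → lookup⇒[]= x C (to T-≡ t))

Adj-sym : ∀ {n} (H : Graph n) {x y} → Adj H x y → Adj H y x
Adj-sym H {x} {y} = subst T (sym H x y)

Adj-irrefl : ∀ {n} (H : Graph n) {x} → ¬ Adj H x x
Adj-irrefl H {x} = subst T (irreflex H x)

Adj⇒≢ : ∀ {n} (H : Graph n) {x y} → Adj H x y → ¬ x ≡ y
Adj⇒≢ H a refl = Adj-irrefl H a

neighbourhood : ∀ {n} → Graph n → Fin n → Subset n
neighbourhood H x = tabulate (adj H x)

∈-neighbourhood⇔Adj : ∀ {n} (H : Graph n) {x y} → y ∈ neighbourhood H x ⇔ Adj H x y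
∈-neighbourhood⇔Adj H {x} {y} = mk⇔
  (λ y∈N → subst T (lookup∘tabulate (adj H x) y) (to ∈⇔T-lookup y∈N))
  (λ a → from ∈⇔T-lookup (subst T (≡-sym (lookup∘tabulate (adj H x) y)) a))

module _ {n} (H : Graph n) (triangleFree : TriangleFree H) where

  common-neighbour⇒Dist2 : ∀ {x y z} → ¬ x ≡ y → Adj H z x → Adj H z y → Dist2 H x y
  common-neighbour⇒Dist2 {x} {y} {z} x≢y zx zy =
    x≢y , (λ xy → triangleFree z x y zx xy zy) , z , Adj-sym H zx , zy

  neighbourhoods-cliqueCollection : ∀ G → IsExactDistSqRoot H G →
                                    CliqueCollection G (neighbourhood H)
  neighbourhoods-cliqueCollection G root =
    isClique , notSelf , symmetric , meets , noTriangle
    where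
    N : Fin n → Subset n
    N = neighbourhood H
    N⇒Adj : ∀ {x y} → y ∈ N x → Adj H x y
    N⇒Adj = to (∈-neighbourhood⇔Adj H)
    Adj⇒N : ∀ {x y} → Adj H x y → y ∈ N x
    Adj⇒N = from (∈-neighbourhood⇔Adj H)

    isClique : ∀ i → IsClique G (N i)
    isClique i x y x∈ y∈ x≢y =
      from (root x y) (common-neighbour⇒Dist2 x≢y (N⇒Adj x∈) (N⇒Adj y∈))

    notSelf : ∀ i → i ∉ N i
    notSelf i i∈ = Adj-irrefl H (N⇒Adj i∈)

    symmetric : ∀ i j → i ∈ N j → j ∈ N i
    symmetric i j i∈ = Adj⇒N (Adj-sym H (N⇒Adj i∈))

    meets : ∀ i j → ¬ i ≡ j → (Adj G i j ⇔ Meets (N i) (N j))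
    meets i j i≢j = mk⇔
      (λ ij → let (_ , _ , z , iz , zj) = to (root i j) ij
              in z , Adj⇒N iz , Adj⇒N (Adj-sym H zj))
      (λ { (z , z∈i , z∈j) → from (root i j)
             (common-neighbour⇒Dist2 i≢j (Adj-sym H (N⇒Adj z∈i)) (Adj-sym H (N⇒Adj z∈j))) })

    noTriangle : ∀ i j k → j ∈ N i → k ∈ N i → j ∉ N k
    noTriangle i j k j∈ k∈ j∈k = triangleFree i k j (N⇒Adj k∈) (N⇒Adj j∈k) (N⇒Adj j∈)

module _ {n} (Cl : Fin n → Subset n)
         (notSelf : ∀ i → i ∉ Cl i) (symmetric : ∀ i j → i ∈ Cl j → j ∈ Cl i) where

  membershipGraph : Graph n
  membershipGraph = record
    { adj      = λ x y → lookup (Cl x) y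
    ; sym      = λ x y → T-injective (member-swap x y) (member-swap y x)
    ; irreflex = λ x → ¬T⇒≡false (λ t → notSelf x (from ∈⇔T-lookup t))
    }
    where
    member-swap : ∀ x y → T (lookup (Cl x) y) → T (lookup (Cl y) x)
    member-swap x y t = to ∈⇔T-lookup (symmetric y x (from ∈⇔T-lookup t))

  Adj-membershipGraph⇔∈ : ∀ {x y} → Adj membershipGraph x y ⇔ y ∈ Cl x
  Adj-membershipGraph⇔∈ = ⇔-sym ∈⇔T-lookup

  private
    Adj⇒∈ : ∀ {x y} → Adj membershipGraph x y → y ∈ Cl x
    Adj⇒∈ = to Adj-membershipGraph⇔∈
    ∈⇒Adj : ∀ {x y} → y ∈ Cl x → Adj membershipGraph x y
    ∈⇒Adj = from Adj-membershipGraph⇔∈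

  module _ (noTriangle : ∀ i j k → j ∈ Cl i → k ∈ Cl i → j ∉ Cl k) where

    membershipGraph-triangleFree : TriangleFree membershipGraph
    membershipGraph-triangleFree x y z xy yz xz =
      noTriangle x y z (Adj⇒∈ xy) (Adj⇒∈ xz) (symmetric z y (Adj⇒∈ yz))

    membershipGraph-isExactDistSqRoot :
      ∀ G → (∀ i j → ¬ i ≡ j → (Adj G i j ⇔ Meets (Cl i) (Cl j))) →
      IsExactDistSqRoot membershipGraph G
    membershipGraph-isExactDistSqRoot G meets x y = mk⇔ toDist2 fromDist2
      where
      toDist2 : Adj G x y → Dist2 membershipGraph x y
      toDist2 xy with to (meets x y (Adj⇒≢ G xy)) xy
      ... | z , z∈x , z∈y =
        Adj⇒≢ G xy
        , (λ x~y → noTriangle z y x (symmetric z y z∈y) (symmetric z x z∈x) (Adj⇒∈ x~y))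
        , z , ∈⇒Adj z∈x , ∈⇒Adj (symmetric z y z∈y)

      fromDist2 : Dist2 membershipGraph x y → Adj G x y
      fromDist2 (x≢y , _ , z , xz , zy) =
        from (meets x y x≢y) (z , Adj⇒∈ xz , symmetric y z (Adj⇒∈ zy))

theorem7 : ∀ (n : ℕ) (G : Graph n) →
    (∃ λ (H : Graph n) → TriangleFree H × IsExactDistSqRoot H G) ⇔
    (∃ λ (Cl : Fin n → Subset n) → CliqueCollection G Cl)
theorem7 n G = mk⇔
  (λ { (H , triangleFree , root) →
         neighbourhood H , neighbourhoods-cliqueCollection H triangleFree G root })
  -- the clique condition is redundant: it follows from (b) and (c)
  (λ { (Cl , _ , notSelf , symmetric , meets , noTriangle) →
         membershipGraph Cl notSelf symmetric
         , membershipGraph-triangleFree Cl notSelf symmetric noTriangle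
         , membershipGraph-isExactDistSqRoot Cl notSelf symmetric noTriangle G meets })
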